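{- Let $\mathbf{S}=\langle S;\to,\neg,{}^+,{}^-,1\rangle$ be a strong quasi-Wajsberg* algebra. Define $0:=x\to x$, $x\oplus y:=\neg x\to y$ and $-x:=\neg x$ for $x,y\in S$. Then $g(\mathbf{S})=\langle S;\oplus,-,{}^+,{}^-,0,1\rangle$ is a strong quasi-MV* algebra (with $x\vee y=(x^+\oplus(-x^+\oplus y^+)^+)\oplus(x^-\oplus(-x^-\oplus y^-)^+)$).
   Context: A quasi-Wajsberg* algebra is an algebra $\langle W;\to,\neg,{}^+,{}^-,1\rangle$ of type $\langle2,1,1,1,0\rangle$ such that for all $x,y,z$: (QW*1) $x\to y=\neg y\to\neg x$; (QW*2) $(x\to1)\to((y\to1)\to z)=(y\to1)\to((x\to1)\to z)$; (QW*3) $(1\to x)\to1=1$; (QW*4) $(z\to z)\to(x\to y)=x\to y$; (QW*5) $(1\to1)\to x^+=((1\to1)\to x)^+=(x\to1)\to1$ and $(1\to1)\to x^-=((1\to1)\to x)^-=(x\to\neg1)\to\neg1$; (QW*6) $x\to y=(y^+\to x^-)\to(x^+\to y^-)$; (QW*7) $\neg(x\to y)=y\to x$; (QW*8) $\neg\neg x=x$; (QW*9) $(x\to(\neg x\to y))^+=x^+\to(\neg x^+\to y^+)$; (QW*10)–(QW*12) $\vee$ is commutative, associative, and $x\to(y\vee z)=(x\to y)\vee(x\to z)$; where $x\vee y:=((x^+\to y^+)^+\to(\neg x)^-)\to((y^-\to x^-)^-\to x^-)$. In such an algebra $x\to x$ does not depend on $x$. It is strong if $x^+=(1\to1)\to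 x^+$ and $x^-=(1\to1)\to x^-$ for all $x$. A quasi-MV* algebra is an algebra $\langle A;\oplus,-,{}^+,{}^-,0,1\rangle$ of type $\langle 2,1,1,1,0,0\rangle$ such that for all $x,y,z$: (1) $x\oplus y=y\oplus x$; (2) $(1\oplus x)\oplus(y\oplus(1\oplus z))=((1\oplus x)\oplus y)\oplus(1\oplus z)$; (3) $(x\oplus1)\oplus1=1$; (4) $(x\oplus y)\oplus0=x\oplus y$; (5) $x^+\oplus0=(x\oplus0)^+=1\oplus(-1\oplus x)$ and $x^-\oplus0=(x\oplus0)^-=-1\oplus(1\oplus x)$; (6) $x\oplus y=(x^+\oplus y^+)\oplus(x^-\oplus y^-)$; (7) $0=-0$; (8) $x\oplus(-x)=0$; (9) $-(x\oplus y)=(-x)\oplus(-y)$; (10) $-(-x)=x$; (11) $(-x\oplus(x\oplus y))^+=-x^+\oplus(x^+\oplus y^+)$; (12)–(14) $\vee$ is commutative, associative, and $x\oplus(y\vee z)=(x\oplus y)\vee(x\oplus z)$; where $x\vee y:=(x^+\oplus(-x^+\oplus y^+)^+)\oplus(x^-\oplus(-x^-\oplus y^-)^+)$. It is strong if $x^+=x^+\oplus0$ and $x^-=x^-\oplus0$ for all $x$. -}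

module Defs where

open import Level using (Level)
open import Relation.Binary.PropositionalEquality using (_≡_)

qw-join : ∀ {a} {W : Set a} (_⇒_ : W → W → W) (¬_ _⁺ _⁻ : W → W) → W → W → W
qw-join _⇒_ ¬_ _⁺ _⁻ x y =
  ((((x ⁺) ⇒ (y ⁺)) ⁺) ⇒ ((¬ x) ⁻)) ⇒ (((((y ⁻) ⇒ (x ⁻)) ⁻) ⇒ (x ⁻)))

record IsQuasiWajsbergStar {a} (W : Set a) (_⇒_ : W → W → W) (¬_ _⁺ _⁻ : W → W) (𝟙 : W) : Set a where
  _∨_ : W → W → W
  _∨_ = qw-join _⇒_ ¬_ _⁺ _⁻
  field
    qw1  : ∀ x y → x ⇒ y ≡ (¬ y) ⇒ (¬ x)
    qw2  : ∀ x y z → (x ⇒ 𝟙) ⇒ ((y ⇒ 𝟙) ⇒ z) ≡ (y ⇒ 𝟙) ⇒ ((x ⇒ 𝟙) ⇒ z)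
    qw3  : ∀ x → (𝟙 ⇒ x) ⇒ 𝟙 ≡ 𝟙
    qw4  : ∀ x y z → (z ⇒ z) ⇒ (x ⇒ y) ≡ x ⇒ y
    qw5a : ∀ x → (𝟙 ⇒ 𝟙) ⇒ (x ⁺) ≡ ((𝟙 ⇒ 𝟙) ⇒ x) ⁺
    qw5b : ∀ x → ((𝟙 ⇒ 𝟙) ⇒ x) ⁺ ≡ (x ⇒ 𝟙) ⇒ 𝟙
    qw5c : ∀ x → (𝟙 ⇒ 𝟙) ⇒ (x ⁻) ≡ ((𝟙 ⇒ 𝟙) ⇒ x) ⁻
    qw5d : ∀ x → ((𝟙 ⇒ 𝟙) ⇒ x) ⁻ ≡ (x ⇒ (¬ 𝟙)) ⇒ (¬ 𝟙)
    qw6  : ∀ x y → x ⇒ y ≡ ((y ⁺) ⇒ (x ⁻)) ⇒ ((x ⁺) ⇒ (y ⁻))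
    qw7  : ∀ x y → ¬ (x ⇒ y) ≡ y ⇒ x
    qw8  : ∀ x → ¬ (¬ x) ≡ x
    qw9  : ∀ x y → (x ⇒ ((¬ x) ⇒ y)) ⁺ ≡ (x ⁺) ⇒ ((¬ (x ⁺)) ⇒ (y ⁺))
    qw10 : ∀ x y → x ∨ y ≡ y ∨ x
    qw11 : ∀ x y z → x ∨ (y ∨ z) ≡ (x ∨ y) ∨ z
    qw12 : ∀ x y z → x ⇒ (y ∨ z) ≡ (x ⇒ y) ∨ (x ⇒ z)

record IsStrongQuasiWajsbergStar {a} (W : Set a) (_⇒_ : W → W → W) (¬_ _⁺ _⁻ : W → W) (𝟙 : W) : Set a where
  field
    isQW     : IsQuasiWajsbergStar W _⇒_ ¬_ _⁺ _⁻ 𝟙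
    strong⁺  : ∀ x → x ⁺ ≡ (𝟙 ⇒ 𝟙) ⇒ (x ⁺)
    strong⁻  : ∀ x → x ⁻ ≡ (𝟙 ⇒ 𝟙) ⇒ (x ⁻)

qmv-join : ∀ {a} {A : Set a} (_⊕_ : A → A → A) (-_ _⁺ _⁻ : A → A) → A → A → A
qmv-join _⊕_ -_ _⁺ _⁻ x y =
  ((x ⁺) ⊕ (((- (x ⁺)) ⊕ (y ⁺)) ⁺)) ⊕ ((x ⁻) ⊕ (((- (x ⁻)) ⊕ (y ⁻)) ⁺))

record IsQuasiMVStar {a} (A : Set a) (_⊕_ : A → A → A) (-_ _⁺ _⁻ : A → A) (𝟘 𝟙 : A) : Set a where
  _∨_ : A → A → A
  _∨_ = qmv-join _⊕_ -_ _⁺ _⁻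
  field
    qmv1  : ∀ x y → x ⊕ y ≡ y ⊕ x
    qmv2  : ∀ x y z → (𝟙 ⊕ x) ⊕ (y ⊕ (𝟙 ⊕ z)) ≡ ((𝟙 ⊕ x) ⊕ y) ⊕ (𝟙 ⊕ z)
    qmv3  : ∀ x → (x ⊕ 𝟙) ⊕ 𝟙 ≡ 𝟙
    qmv4  : ∀ x y → (x ⊕ y) ⊕ 𝟘 ≡ x ⊕ y
    qmv5a : ∀ x → (x ⁺) ⊕ 𝟘 ≡ (x ⊕ 𝟘) ⁺
    qmv5b : ∀ x → (x ⊕ 𝟘) ⁺ ≡ 𝟙 ⊕ ((- 𝟙) ⊕ x)
    qmv5c : ∀ x → (x ⁻) ⊕ 𝟘 ≡ (x ⊕ 𝟘) ⁻
    qmv5d : ∀ x → (x ⊕ 𝟘) ⁻ ≡ (- 𝟙) ⊕ (𝟙 ⊕ x)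
    qmv6  : ∀ x y → x ⊕ y ≡ ((x ⁺) ⊕ (y ⁺)) ⊕ ((x ⁻) ⊕ (y ⁻))
    qmv7  : 𝟘 ≡ - 𝟘
    qmv8  : ∀ x → x ⊕ (- x) ≡ 𝟘
    qmv9  : ∀ x y → - (x ⊕ y) ≡ (- x) ⊕ (- y)
    qmv10 : ∀ x → - (- x) ≡ x
    qmv11 : ∀ x y → ((- x) ⊕ (x ⊕ y)) ⁺ ≡ (- (x ⁺)) ⊕ ((x ⁺) ⊕ (y ⁺))
    qmv12 : ∀ x y → x ∨ y ≡ y ∨ x
    qmv13 : ∀ x y z → x ∨ (y ∨ z) ≡ (x ∨ y) ∨ z
    qmv14 : ∀ x y z → x ⊕ (y ∨ z) ≡ (x ⊕ y) ∨ (x ⊕ z)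

record IsStrongQuasiMVStar {a} (A : Set a) (_⊕_ : A → A → A) (-_ _⁺ _⁻ : A → A) (𝟘 𝟙 : A) : Set a where
  field
    isQMV   : IsQuasiMVStar A _⊕_ -_ _⁺ _⁻ 𝟘 𝟙
    strong⁺ : ∀ x → x ⁺ ≡ (x ⁺) ⊕ 𝟘
    strong⁻ : ∀ x → x ⁻ ≡ (x ⁻) ⊕ 𝟘

-- The construction g(S): x ⊕ y := ¬x → y,  -x := ¬x,  0 := 1 → 1 (= x → x for any x).
g-⊕ : ∀ {a} {S : Set a} (_⇒_ : S → S → S) (¬_ : S → S) → S → S → S
g-⊕ _⇒_ ¬_ x y = (¬ x) ⇒ y

g-𝟘 : ∀ {a} {S : Set a} (_⇒_ : S → S → S) (𝟙 : S) → S
g-𝟘 _⇒_ 𝟙 = 𝟙 ⇒ 𝟙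

-- In g(S) the sum x ⊕ y is ¬x → y, so every quasi-MV* axiom is a quasi-Wajsberg*
-- axiom read through contraposition x → y = ¬y → ¬x and ¬(x → y) = y → x.
-- Strength makes x⁺ = (x → 1) → 1 and x⁻ = (x → ¬1) → ¬1 hold outright, which gives
-- (¬x)⁻ = ¬(x⁺); with it the two joins coincide, and qmv6, qmv12–14 follow from
-- qw6, qw10–12.
module Submission where

open import Defs
open import Relation.Binary.PropositionalEquality
open ≡-Reasoning

module QuasiWajsbergStarProperties
  {a} {S : Set a} {_⇒_ : S → S → S} {¬_ _⁺ _⁻ : S → S} {𝟙 : S}
  (isQW : IsQuasiWajsbergStar S _⇒_ ¬_ _⁺ _⁻ 𝟙) where

  open IsQuasiWajsbergStar isQW

  _⊕_ : S → S → S
  _⊕_ = g-⊕ _⇒_ ¬_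

  𝟘 : S
  𝟘 = g-𝟘 _⇒_ 𝟙

  ⊕-comm : ∀ x y → x ⊕ y ≡ y ⊕ x
  ⊕-comm x y = trans (qw1 (¬ x) y) (cong ((¬ y) ⇒_) (qw8 x))

  ¬x⊕y≡x⇒y : ∀ x y → (¬ x) ⊕ y ≡ x ⇒ y
  ¬x⊕y≡x⇒y x y = cong (_⇒ y) (qw8 x)

  ¬-distrib-⊕ : ∀ x y → ¬ (x ⊕ y) ≡ (¬ x) ⊕ (¬ y)
  ¬-distrib-⊕ x y = trans (qw7 (¬ x) y) (qw1 y (¬ x))

  ¬𝟘≡𝟘 : ¬ 𝟘 ≡ 𝟘
  ¬𝟘≡𝟘 = qw7 𝟙 𝟙

  x⊕𝟘≡𝟘⇒x : ∀ x → x ⊕ 𝟘 ≡ 𝟘 ⇒ x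
  x⊕𝟘≡𝟘⇒x x = trans (⊕-comm x 𝟘) (cong (_⇒ x) ¬𝟘≡𝟘)

  x⇒x≡𝟘 : ∀ x → x ⇒ x ≡ 𝟘
  x⇒x≡𝟘 x = begin
    x ⇒ x                ≡⟨ qw4 x x 𝟙 ⟨
    𝟘 ⇒ (x ⇒ x)          ≡⟨ cong (_⇒ (x ⇒ x)) ¬𝟘≡𝟘 ⟨
    (¬ 𝟘) ⇒ (x ⇒ x)      ≡⟨ ⊕-comm 𝟘 (x ⇒ x) ⟩
    (¬ (x ⇒ x)) ⇒ 𝟘      ≡⟨ cong (_⇒ 𝟘) (qw7 x x) ⟩
    (x ⇒ x) ⇒ 𝟘          ≡⟨ qw4 𝟙 𝟙 x ⟩
    𝟘                    ∎

  [x⊕𝟙]⊕𝟙≡𝟙 : ∀ x → (x ⊕ 𝟙) ⊕ 𝟙 ≡ 𝟙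
  [x⊕𝟙]⊕𝟙≡𝟙 x = trans (cong (_⇒ 𝟙) (qw7 (¬ x) 𝟙)) (qw3 (¬ x))

  [x⊕y]⊕𝟘≡x⊕y : ∀ x y → (x ⊕ y) ⊕ 𝟘 ≡ x ⊕ y
  [x⊕y]⊕𝟘≡x⊕y x y = trans (x⊕𝟘≡𝟘⇒x (x ⊕ y)) (qw4 (¬ x) y 𝟙)

  [x⇒c]⇒c≡c⊕[¬c⊕x] : ∀ x c → (x ⇒ c) ⇒ c ≡ c ⊕ ((¬ c) ⊕ x)
  [x⇒c]⇒c≡c⊕[¬c⊕x] x c = begin
    (x ⇒ c) ⇒ c          ≡⟨ qw1 (x ⇒ c) c ⟩
    (¬ c) ⇒ (¬ (x ⇒ c))  ≡⟨ cong ((¬ c) ⇒_) (qw7 x c) ⟩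
    (¬ c) ⇒ (c ⇒ x)      ≡⟨ cong ((¬ c) ⇒_) (¬x⊕y≡x⇒y c x) ⟨
    c ⊕ ((¬ c) ⊕ x)      ∎

  [x⊕𝟘]⁺≡𝟙⊕[¬𝟙⊕x] : ∀ x → (x ⊕ 𝟘) ⁺ ≡ 𝟙 ⊕ ((¬ 𝟙) ⊕ x)
  [x⊕𝟘]⁺≡𝟙⊕[¬𝟙⊕x] x =
    trans (cong _⁺ (x⊕𝟘≡𝟘⇒x x)) (trans (qw5b x) ([x⇒c]⇒c≡c⊕[¬c⊕x] x 𝟙))

  [x⊕𝟘]⁻≡¬𝟙⊕[𝟙⊕x] : ∀ x → (x ⊕ 𝟘) ⁻ ≡ (¬ 𝟙) ⊕ (𝟙 ⊕ x)
  [x⊕𝟘]⁻≡¬𝟙⊕[𝟙⊕x] x = begin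
    (x ⊕ 𝟘) ⁻                  ≡⟨ cong _⁻ (x⊕𝟘≡𝟘⇒x x) ⟩
    (𝟘 ⇒ x) ⁻                  ≡⟨ qw5d x ⟩
    (x ⇒ (¬ 𝟙)) ⇒ (¬ 𝟙)        ≡⟨ [x⇒c]⇒c≡c⊕[¬c⊕x] x (¬ 𝟙) ⟩
    (¬ 𝟙) ⊕ ((¬ (¬ 𝟙)) ⊕ x)    ≡⟨ cong (λ u → (¬ 𝟙) ⊕ (u ⊕ x)) (qw8 𝟙) ⟩
    (¬ 𝟙) ⊕ (𝟙 ⊕ x)            ∎

  x⁺⊕𝟘≡[x⊕𝟘]⁺ : ∀ x → (x ⁺) ⊕ 𝟘 ≡ (x ⊕ 𝟘) ⁺
  x⁺⊕𝟘≡[x⊕𝟘]⁺ x =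
    trans (x⊕𝟘≡𝟘⇒x (x ⁺)) (trans (qw5a x) (cong _⁺ (sym (x⊕𝟘≡𝟘⇒x x))))

  x⁻⊕𝟘≡[x⊕𝟘]⁻ : ∀ x → (x ⁻) ⊕ 𝟘 ≡ (x ⊕ 𝟘) ⁻
  x⁻⊕𝟘≡[x⊕𝟘]⁻ x =
    trans (x⊕𝟘≡𝟘⇒x (x ⁻)) (trans (qw5c x) (cong _⁻ (sym (x⊕𝟘≡𝟘⇒x x))))

  [[q⇒𝟙]⇒z]⇒[p⇒𝟙]-exchange : ∀ p q z →
    ((q ⇒ 𝟙) ⇒ z) ⇒ (p ⇒ 𝟙) ≡ ((p ⇒ 𝟙) ⇒ z) ⇒ (q ⇒ 𝟙)
  [[q⇒𝟙]⇒z]⇒[p⇒𝟙]-exchange p q z =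
    trans (sym (qw7 (p ⇒ 𝟙) ((q ⇒ 𝟙) ⇒ z)))
      (trans (cong ¬_ (qw2 p q z)) (qw7 (q ⇒ 𝟙) ((p ⇒ 𝟙) ⇒ z)))

  ⊕-assoc-⇒𝟙 : ∀ p y q → (p ⇒ 𝟙) ⊕ (y ⊕ (q ⇒ 𝟙)) ≡ ((p ⇒ 𝟙) ⊕ y) ⊕ (q ⇒ 𝟙)
  ⊕-assoc-⇒𝟙 p y q = begin
    (p ⇒ 𝟙) ⊕ (y ⊕ (q ⇒ 𝟙))          ≡⟨ ⊕-comm (p ⇒ 𝟙) (y ⊕ (q ⇒ 𝟙)) ⟩
    (¬ (y ⊕ (q ⇒ 𝟙))) ⇒ (p ⇒ 𝟙)      ≡⟨ cong (_⇒ (p ⇒ 𝟙)) (qw7 (¬ y) (q ⇒ 𝟙)) ⟩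
    ((q ⇒ 𝟙) ⇒ (¬ y)) ⇒ (p ⇒ 𝟙)      ≡⟨ [[q⇒𝟙]⇒z]⇒[p⇒𝟙]-exchange p q (¬ y) ⟩
    ((p ⇒ 𝟙) ⇒ (¬ y)) ⇒ (q ⇒ 𝟙)      ≡⟨ cong (_⇒ (q ⇒ 𝟙)) (¬x⊕y≡x⇒y (p ⇒ 𝟙) (¬ y)) ⟨
    ((¬ (p ⇒ 𝟙)) ⊕ (¬ y)) ⇒ (q ⇒ 𝟙)  ≡⟨ cong (_⇒ (q ⇒ 𝟙)) (¬-distrib-⊕ (p ⇒ 𝟙) y) ⟨
    ((p ⇒ 𝟙) ⊕ y) ⊕ (q ⇒ 𝟙)          ∎

  ⊕-assoc-𝟙⊕ : ∀ x y z → (𝟙 ⊕ x) ⊕ (y ⊕ (𝟙 ⊕ z)) ≡ ((𝟙 ⊕ x) ⊕ y) ⊕ (𝟙 ⊕ z)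
  ⊕-assoc-𝟙⊕ x y z =
    subst₂ (λ c d → c ⊕ (y ⊕ d) ≡ (c ⊕ y) ⊕ d)
      (sym (⊕-comm 𝟙 x)) (sym (⊕-comm 𝟙 z)) (⊕-assoc-⇒𝟙 (¬ x) y (¬ z))

  [¬x⊕[x⊕y]]⁺≡¬x⁺⊕[x⁺⊕y⁺] : ∀ x y →
    ((¬ x) ⊕ (x ⊕ y)) ⁺ ≡ (¬ (x ⁺)) ⊕ ((x ⁺) ⊕ (y ⁺))
  [¬x⊕[x⊕y]]⁺≡¬x⁺⊕[x⁺⊕y⁺] x y =
    trans (cong _⁺ (¬x⊕y≡x⇒y x (x ⊕ y)))
      (trans (qw9 x y) (sym (¬x⊕y≡x⇒y (x ⁺) ((x ⁺) ⊕ (y ⁺)))))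

module StrongQuasiWajsbergStarProperties
  {a} {S : Set a} {_⇒_ : S → S → S} {¬_ _⁺ _⁻ : S → S} {𝟙 : S}
  (isSQW : IsStrongQuasiWajsbergStar S _⇒_ ¬_ _⁺ _⁻ 𝟙) where

  open IsStrongQuasiWajsbergStar isSQW
  open IsQuasiWajsbergStar isQW
  open QuasiWajsbergStarProperties isQW public

  x⁺≡[x⇒𝟙]⇒𝟙 : ∀ x → x ⁺ ≡ (x ⇒ 𝟙) ⇒ 𝟙
  x⁺≡[x⇒𝟙]⇒𝟙 x = trans (strong⁺ x) (trans (qw5a x) (qw5b x))

  x⁻≡[x⇒¬𝟙]⇒¬𝟙 : ∀ x → x ⁻ ≡ (x ⇒ (¬ 𝟙)) ⇒ (¬ 𝟙)
  x⁻≡[x⇒¬𝟙]⇒¬𝟙 x = trans (strong⁻ x) (trans (qw5c x) (qw5d x))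

  [¬x]⁻≡¬[x⁺] : ∀ x → (¬ x) ⁻ ≡ ¬ (x ⁺)
  [¬x]⁻≡¬[x⁺] x = begin
    (¬ x) ⁻                          ≡⟨ x⁻≡[x⇒¬𝟙]⇒¬𝟙 (¬ x) ⟩
    ((¬ x) ⇒ (¬ 𝟙)) ⇒ (¬ 𝟙)          ≡⟨ cong (_⇒ (¬ 𝟙)) (qw1 𝟙 x) ⟨
    (𝟙 ⇒ x) ⇒ (¬ 𝟙)                  ≡⟨ qw1 (𝟙 ⇒ x) (¬ 𝟙) ⟩
    (¬ (¬ 𝟙)) ⇒ (¬ (𝟙 ⇒ x))          ≡⟨ cong₂ _⇒_ (qw8 𝟙) (qw7 𝟙 x) ⟩
    𝟙 ⇒ (x ⇒ 𝟙)                      ≡⟨ qw7 (x ⇒ 𝟙) 𝟙 ⟨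
    ¬ ((x ⇒ 𝟙) ⇒ 𝟙)                  ≡⟨ cong ¬_ (x⁺≡[x⇒𝟙]⇒𝟙 x) ⟨
    ¬ (x ⁺)                          ∎

  [¬x]⁺≡¬[x⁻] : ∀ x → (¬ x) ⁺ ≡ ¬ (x ⁻)
  [¬x]⁺≡¬[x⁻] x = begin
    (¬ x) ⁺              ≡⟨ qw8 ((¬ x) ⁺) ⟨
    ¬ (¬ ((¬ x) ⁺))      ≡⟨ cong ¬_ ([¬x]⁻≡¬[x⁺] (¬ x)) ⟨
    ¬ ((¬ (¬ x)) ⁻)      ≡⟨ cong (λ u → ¬ (u ⁻)) (qw8 x) ⟩
    ¬ (x ⁻)              ∎

  x⊕y≡[x⁺⊕y⁺]⊕[x⁻⊕y⁻] : ∀ x y → x ⊕ y ≡ ((x ⁺) ⊕ (y ⁺)) ⊕ ((x ⁻) ⊕ (y ⁻))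
  x⊕y≡[x⁺⊕y⁺]⊕[x⁻⊕y⁻] x y = begin
    x ⊕ y                                            ≡⟨ qw6 (¬ x) y ⟩
    ((y ⁺) ⇒ ((¬ x) ⁻)) ⇒ (((¬ x) ⁺) ⇒ (y ⁻))        ≡⟨ cong₂ (λ u v → ((y ⁺) ⇒ u) ⇒ (v ⇒ (y ⁻)))
                                                          ([¬x]⁻≡¬[x⁺] x) ([¬x]⁺≡¬[x⁻] x) ⟩
    ((y ⁺) ⇒ (¬ (x ⁺))) ⇒ ((¬ (x ⁻)) ⇒ (y ⁻))        ≡⟨ cong (_⇒ ((¬ (x ⁻)) ⇒ (y ⁻))) (qw7 (¬ (x ⁺)) (y ⁺)) ⟨
    ((x ⁺) ⊕ (y ⁺)) ⊕ ((x ⁻) ⊕ (y ⁻))                ∎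

  _∨⊕_ _∨⇒_ : S → S → S
  _∨⊕_ = qmv-join _⊕_ ¬_ _⁺ _⁻
  _∨⇒_ = qw-join _⇒_ ¬_ _⁺ _⁻

  ∨⊕≡∨⇒ : ∀ x y → x ∨⊕ y ≡ x ∨⇒ y
  ∨⊕≡∨⇒ x y = cong₂ _⇒_ positive-part negative-part
    where
    positive-part : ¬ ((x ⁺) ⊕ (((¬ (x ⁺)) ⊕ (y ⁺)) ⁺)) ≡ (((x ⁺) ⇒ (y ⁺)) ⁺) ⇒ ((¬ x) ⁻)
    positive-part = begin
      ¬ ((x ⁺) ⊕ (((¬ (x ⁺)) ⊕ (y ⁺)) ⁺))   ≡⟨ qw7 (¬ (x ⁺)) _ ⟩
      (((¬ (x ⁺)) ⊕ (y ⁺)) ⁺) ⇒ (¬ (x ⁺))   ≡⟨ cong₂ (λ u v → (u ⁺) ⇒ v)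
                                                 (¬x⊕y≡x⇒y (x ⁺) (y ⁺)) (sym ([¬x]⁻≡¬[x⁺] x)) ⟩
      (((x ⁺) ⇒ (y ⁺)) ⁺) ⇒ ((¬ x) ⁻)       ∎

    negative-part : (x ⁻) ⊕ (((¬ (x ⁻)) ⊕ (y ⁻)) ⁺) ≡ (((y ⁻) ⇒ (x ⁻)) ⁻) ⇒ (x ⁻)
    negative-part = begin
      (x ⁻) ⊕ (((¬ (x ⁻)) ⊕ (y ⁻)) ⁺)       ≡⟨ ⊕-comm (x ⁻) _ ⟩
      (¬ (((¬ (x ⁻)) ⊕ (y ⁻)) ⁺)) ⇒ (x ⁻)   ≡⟨ cong (_⇒ (x ⁻)) ([¬x]⁻≡¬[x⁺] ((¬ (x ⁻)) ⊕ (y ⁻))) ⟨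
      ((¬ ((¬ (x ⁻)) ⊕ (y ⁻))) ⁻) ⇒ (x ⁻)   ≡⟨ cong (λ u → ((¬ u) ⁻) ⇒ (x ⁻)) (¬x⊕y≡x⇒y (x ⁻) (y ⁻)) ⟩
      ((¬ ((x ⁻) ⇒ (y ⁻))) ⁻) ⇒ (x ⁻)       ≡⟨ cong (λ u → (u ⁻) ⇒ (x ⁻)) (qw7 (x ⁻) (y ⁻)) ⟩
      (((y ⁻) ⇒ (x ⁻)) ⁻) ⇒ (x ⁻)           ∎

  ∨⊕-comm : ∀ x y → x ∨⊕ y ≡ y ∨⊕ x
  ∨⊕-comm x y = trans (∨⊕≡∨⇒ x y) (trans (qw10 x y) (sym (∨⊕≡∨⇒ y x)))

  ∨⊕-assoc : ∀ x y z → x ∨⊕ (y ∨⊕ z) ≡ (x ∨⊕ y) ∨⊕ z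
  ∨⊕-assoc x y z = begin
    x ∨⊕ (y ∨⊕ z)    ≡⟨ cong (x ∨⊕_) (∨⊕≡∨⇒ y z) ⟩
    x ∨⊕ (y ∨⇒ z)    ≡⟨ ∨⊕≡∨⇒ x (y ∨⇒ z) ⟩
    x ∨⇒ (y ∨⇒ z)    ≡⟨ qw11 x y z ⟩
    (x ∨⇒ y) ∨⇒ z    ≡⟨ ∨⊕≡∨⇒ (x ∨⇒ y) z ⟨
    (x ∨⇒ y) ∨⊕ z    ≡⟨ cong (_∨⊕ z) (∨⊕≡∨⇒ x y) ⟨
    (x ∨⊕ y) ∨⊕ z    ∎

  ⊕-distribˡ-∨⊕ : ∀ x y z → x ⊕ (y ∨⊕ z) ≡ (x ⊕ y) ∨⊕ (x ⊕ z)
  ⊕-distribˡ-∨⊕ x y z =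
    trans (cong ((¬ x) ⇒_) (∨⊕≡∨⇒ y z))
      (trans (qw12 (¬ x) y z) (sym (∨⊕≡∨⇒ ((¬ x) ⇒ y) ((¬ x) ⇒ z))))

  isQuasiMVStar : IsQuasiMVStar S _⊕_ ¬_ _⁺ _⁻ 𝟘 𝟙
  isQuasiMVStar = record
    { qmv1  = ⊕-comm
    ; qmv2  = ⊕-assoc-𝟙⊕
    ; qmv3  = [x⊕𝟙]⊕𝟙≡𝟙
    ; qmv4  = [x⊕y]⊕𝟘≡x⊕y
    ; qmv5a = x⁺⊕𝟘≡[x⊕𝟘]⁺
    ; qmv5b = [x⊕𝟘]⁺≡𝟙⊕[¬𝟙⊕x]
    ; qmv5c = x⁻⊕𝟘≡[x⊕𝟘]⁻
    ; qmv5d = [x⊕𝟘]⁻≡¬𝟙⊕[𝟙⊕x]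
    ; qmv6  = x⊕y≡[x⁺⊕y⁺]⊕[x⁻⊕y⁻]
    ; qmv7  = sym ¬𝟘≡𝟘
    ; qmv8  = λ x → x⇒x≡𝟘 (¬ x)
    ; qmv9  = ¬-distrib-⊕
    ; qmv10 = qw8
    ; qmv11 = [¬x⊕[x⊕y]]⁺≡¬x⁺⊕[x⁺⊕y⁺]
    ; qmv12 = ∨⊕-comm
    ; qmv13 = ∨⊕-assoc
    ; qmv14 = ⊕-distribˡ-∨⊕
    }

proposition3p5 : ∀ {a} (S : Set a) (_⇒_ : S → S → S) (¬_ _⁺ _⁻ : S → S) (𝟙 : S) →
    IsStrongQuasiWajsbergStar S _⇒_ ¬_ _⁺ _⁻ 𝟙 →
    IsStrongQuasiMVStar S (g-⊕ _⇒_ ¬_) ¬_ _⁺ _⁻ (g-𝟘 _⇒_ 𝟙) 𝟙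
proposition3p5 S _⇒_ ¬_ _⁺ _⁻ 𝟙 isSQW = record
  { isQMV   = isQuasiMVStar
  ; strong⁺ = λ x → trans (strong⁺ x) (sym (x⊕𝟘≡𝟘⇒x (x ⁺)))
  ; strong⁻ = λ x → trans (strong⁻ x) (sym (x⊕𝟘≡𝟘⇒x (x ⁻)))
  }
  where
  open IsStrongQuasiWajsbergStar isSQW
  open StrongQuasiWajsbergStarProperties isSQW
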